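{- For every $\mathbb{N}$-vector $\mathbf c$, the back stable slide $\overleftarrow{\mathfrak{F}}_{\mathbf c}$ lies in $\overleftarrow{QR}$. Consequently, $\overleftarrow{K}_{(P,\Phi)}\in\overleftarrow{QR}$ for every finite poset $P$ and every injective map $\Phi:P\to\overline{\mathbb{Z}}$.
   Context: Variables $\mathbf x=\{x_i:i\in\mathbb{Z}\}$. $\overleftarrow{QR}$ is the space of back quasisymmetric functions: bounded-degree series $f\in\mathbb{Q}[[\mathbf x]]$ involving no $x_i$ for $i$ larger than some $N$, for which there is $b\in\mathbb{Z}$ such that for all positive integers $(a_1,\dots,a_k)$ and all monomials $\mathsf m$ in $\{x_i:i>b\}$, the coefficient of $x_{i_1}^{a_1}\cdots x_{i_k}^{a_k}\mathsf m$ is the same for all $i_1<\cdots<i_k\le b$. $\overline{\mathbb{Z}}$ is the totally ordered alphabet of symbols $i_j$ with $i\in\mathbb{Z}$, $j\in\mathbb{Z}_{>0}$, ordered lexicographically, with $\mathrm{val}(i_j)=i$. An $\mathbb{N}$-vector is a finitely supported sequence $(c_i)_{i\in\mathbb{Z}}$ of nonnegative integers; $W_{\mathbf c}$ is the word of the letters $i_j$ with $1\le j\le c_i$, arranged with $i$ decreasing and for fixed $i$ with $j$ increasing. For an injective word $W=a_1\cdots a_r$ in $\overline{\mathbb{Z}}$, $\overleftarrow{\mathfrak{F}}(W)=\sum x_{i_1}\cdots x_{i_r}$ over integers $i_1\ge\cdots\ge i_r$ with $i_j>i_{j+1}$ whenever $a_j>a_{j+1}$ and $i_j\le\mathrm{val}(a_j)$;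 $\overleftarrow{\mathfrak{F}}_{\mathbf c}=\overleftarrow{\mathfrak{F}}(W_{\mathbf c})$. For a finite poset $P$ (with $u\prec_P v$ meaning $v$ covers $u$) and injective $\Phi:P\to\overline{\mathbb{Z}}$, a back stable $(P,\Phi)$-partition is $f:P\to\mathbb{Z}$ with $f(u)\ge f(v)$ if $u\prec_P v$; $f(u)>f(v)$ if $u\prec_P v$ and $\Phi(u)>\Phi(v)$; $f(u)\le\mathrm{val}(\Phi(u))$; and $\overleftarrow{K}_{(P,\Phi)}=\sum_f\prod_{u\in P}x_{f(u)}$ over all such $f$. -}

module Defs where

open import Level using (0ℓ)
open import Data.Bool using (Bool; true; false; if_then_else_)
open import Data.Nat as ℕ using (ℕ; zero; suc)
open import Data.Integer as ℤ using (ℤ; +_; _-_; ∣_∣)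
open import Data.Integer.Properties as ℤP using (≤-decTotalOrder)
open import Data.Rational using (ℚ; 0ℚ; 1ℚ; _/_)
open import Data.Fin using (Fin)
open import Data.Fin.Properties using (all?)
open import Data.Vec as Vec using (Vec; []; _∷_; lookup)
open import Data.List as List
  using (List; []; _∷_; _++_; length; map; concat; concatMap; reverse;
         zipWith; replicate; upTo; allFin; filter; deduplicate)
open import Data.List.Properties using (≡-dec)
open import Data.List.Relation.Unary.All using (All)
open import Data.List.Relation.Unary.Any using (Any)
open import Data.List.Relation.Unary.Linked using (Linked)
open import Data.Product using (Σ; ∃; _×_; _,_; proj₁; proj₂)
open import Data.Sum using (_⊎_)
open import Data.Unit using (⊤; tt)
open import Data.Empty using (⊥)
open import Relation.Nullary using (¬_; Dec; yes; no; _×-dec_; _→-dec_; ¬?)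
open import Relation.Nullary.Decidable using (⌊_⌋)
open import Relation.Binary.PropositionalEquality using (_≡_; _≢_)
open import Relation.Binary.Structures using (IsDecPartialOrder)
open import Relation.Binary.Definitions using (Decidable)
import Data.List.Sort.InsertionSort as Sort

-- A monomial x_{i_1} x_{i_2} ⋯ x_{i_r} is represented by the unique
-- weakly decreasing list [i_1, …, i_r] (i_1 ≥ ⋯ ≥ i_r) of the indices of
-- its variables, counted with multiplicity.  A series is its coefficient
-- function; only its values on weakly decreasing lists are meaningful.

IsMonomial : List ℤ → Set
IsMonomial = Linked ℤ._≥_

Series : Set
Series = List ℤ → ℚ

-- The monomial x_{i_1}^{a_1} ⋯ x_{i_k}^{a_k} (for i_1 < ⋯ < i_k), as a
-- weakly decreasing list: i_k repeated a_k times, …, i_1 repeated a_1 times.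
block : List ℤ → List ℕ → List ℤ
block is as = concat (reverse (zipWith (λ i a → replicate a i) is as))

BoundedDegree : Series → Set
BoundedDegree F = ∃ λ (D : ℕ) → ∀ L → IsMonomial L → D ℕ.< length L → F L ≡ 0ℚ

NoLargeVariables : Series → Set
NoLargeVariables F = ∃ λ (N : ℤ) → ∀ L → IsMonomial L → Any (N ℤ.<_) L → F L ≡ 0ℚ

BackQuasisymmetric : Series → Set
BackQuasisymmetric F = ∃ λ (b : ℤ) →
  ∀ (as : List ℕ) → All (1 ℕ.≤_) as →
  ∀ (m : List ℤ) → IsMonomial m → All (b ℤ.<_) m →
  ∀ (is js : List ℤ) →
    length is ≡ length as → Linked ℤ._<_ is → All (ℤ._≤ b) is →
    length js ≡ length as → Linked ℤ._<_ js → All (ℤ._≤ b) js →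
    F (m ++ block is as) ≡ F (m ++ block js as)

InQR : Series → Set
InQR F = BoundedDegree F × NoLargeVariables F × BackQuasisymmetric F

-- The alphabet ℤ̄ : letters i_j with i ∈ ℤ, j ∈ ℤ_{>0}.
-- The letter i_j is represented as the pair (i , j) with j ≥ 1.

record Letter : Set where
  constructor _⟨_⟩
  field
    val : ℤ
    sub : ℕ
    .{sub-pos} : 1 ℕ.≤ sub
open Letter public

_<ᴸ_ : Letter → Letter → Set
a <ᴸ b = (val a ℤ.< val b) ⊎ (val a ≡ val b × sub a ℕ.< sub b)

record NVector : Set where
  field
    coeff   : ℤ → ℕ
    lo hi   : ℤ
    support : ∀ i → coeff i ≢ 0 → (lo ℤ.≤ i) × (i ℤ.≤ hi)
open NVector public

descRange : ℤ → ℕ → List ℤ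
descRange h zero    = []
descRange h (suc n) = h ∷ descRange (h - + 1) n

lettersAt : ℤ → ℕ → List Letter
lettersAt i k = map (λ j → record { val = i ; sub = suc j ; sub-pos = ℕ.s≤s ℕ.z≤n }) (upTo k)

-- W_c : letters i_j (1 ≤ j ≤ c_i), i decreasing, then j increasing.
-- The range hi, hi-1, … covers [lo, hi]; extra indices have c_i = 0.
W : NVector → List Letter
W c = concatMap (λ i → lettersAt i (coeff c i))
                (descRange (hi c) (suc ∣ hi c - lo c ∣))

-- Coefficient of the monomial with weakly decreasing index list
-- [i_1,…,i_r]: it is 1 if i_1 ≥ ⋯ ≥ i_r satisfies the slide conditions
-- for W = a_1 ⋯ a_r, and 0 otherwise (the sequence is determined by the
-- monomial).

SlideCond : List Letter → List ℤ → Set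
SlideCond []      []      = ⊤
SlideCond []      (_ ∷ _) = ⊥
SlideCond (_ ∷ _) []      = ⊥
SlideCond (a ∷ []) (i ∷ []) = i ℤ.≤ val a
SlideCond (a ∷ []) (i ∷ _ ∷ _) = ⊥
SlideCond (a ∷ _ ∷ _) (i ∷ []) = ⊥
SlideCond (a ∷ b ∷ w) (i ∷ k ∷ L) =
  (i ℤ.≤ val a) × (k ℤ.≤ i) × (b <ᴸ a → k ℤ.< i) × SlideCond (b ∷ w) (k ∷ L)

_<ᴸ?_ : Decidable _<ᴸ_
a <ᴸ? b with val a ℤ.<? val b
... | yes p = yes (_⊎_.inj₁ p)
... | no ¬p with val a ℤP.≟ val b | sub a ℕ.<? sub b
...   | yes e | yes s = yes (_⊎_.inj₂ (e , s))
...   | no ¬e | _     = no λ { (_⊎_.inj₁ p) → ¬p p ; (_⊎_.inj₂ (e , _)) → ¬e e }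
...   | yes _ | no ¬s = no λ { (_⊎_.inj₁ p) → ¬p p ; (_⊎_.inj₂ (_ , s)) → ¬s s }

slideCond? : ∀ w L → Dec (SlideCond w L)
slideCond? []      []      = yes tt
slideCond? []      (_ ∷ _) = no λ ()
slideCond? (_ ∷ _) []      = no λ ()
slideCond? (a ∷ []) (i ∷ []) = i ℤ.≤? val a
slideCond? (a ∷ []) (i ∷ _ ∷ _) = no λ ()
slideCond? (a ∷ _ ∷ _) (i ∷ []) = no λ ()
slideCond? (a ∷ b ∷ w) (i ∷ k ∷ L) =
  (i ℤ.≤? val a) ×-dec (k ℤ.≤? i) ×-dec ((b <ᴸ? a) →-dec (k ℤ.<? i))
    ×-dec slideCond? (b ∷ w) (k ∷ L)

slide : List Letter → Series
slide w L = if ⌊ slideCond? w L ⌋ then 1ℚ else 0ℚ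

slideC : NVector → Series
slideC c = slide (W c)

-- Finite posets.  A finite poset is represented (up to isomorphism) on
-- the carrier Fin n by a decidable partial order.

record FinPoset (n : ℕ) : Set₁ where
  field
    _≤P_ : Fin n → Fin n → Set
    isDecPartialOrder : IsDecPartialOrder _≡_ _≤P_
  open IsDecPartialOrder isDecPartialOrder public using (_≟_; _≤?_)

  _<P_ : Fin n → Fin n → Set
  u <P v = (u ≤P v) × (u ≢ v)

  _<P?_ : Decidable _<P_
  u <P? v = (u ≤? v) ×-dec ¬? (u ≟ v)

  _≺_ : Fin n → Fin n → Set
  u ≺ v = (u <P v) × (∀ w → ¬ ((u <P w) × (w <P v)))

  _≺?_ : Decidable _≺_
  u ≺? v = (u <P? v) ×-dec all? (λ w → ¬? ((u <P? w) ×-dec (w <P? v)))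

open FinPoset public

IsPPartition : ∀ {n} → FinPoset n → (Fin n → Letter) → (Fin n → ℤ) → Set
IsPPartition P Φ f =
  (∀ u v → _≺_ P u v → (f v ℤ.≤ f u) × (Φ v <ᴸ Φ u → f v ℤ.< f u)) ×
  (∀ u → f u ℤ.≤ val (Φ u))

isPPartition? : ∀ {n} (P : FinPoset n) Φ f → Dec (IsPPartition P Φ f)
isPPartition? P Φ f =
  all? (λ u → all? (λ v → _≺?_ P u v →-dec
          ((f v ℤ.≤? f u) ×-dec ((Φ v <ᴸ? Φ u) →-dec (f v ℤ.<? f u)))))
  ×-dec all? (λ u → f u ℤ.≤? val (Φ u))

module ℤSort = Sort ≤-decTotalOrder

monomialOf : ∀ {n} → (Fin n → ℤ) → List ℤ
monomialOf {n} f = reverse (ℤSort.sort (map f (allFin n)))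

allVecs : List ℤ → (n : ℕ) → List (Vec ℤ n)
allVecs S zero    = [] ∷ []
allVecs S (suc n) = concatMap (λ x → map (x ∷_) (allVecs S n)) S

-- Any such f takes values among the entries of L; each such f is
-- enumerated exactly once as lookup v for v ∈ allVecs (dedup L) n.
countPPartitions : ∀ {n} → FinPoset n → (Fin n → Letter) → List ℤ → ℕ
countPPartitions {n} P Φ L =
  length (filter (λ v → isPPartition? P Φ (lookup v)
                         ×-dec ≡-dec ℤ._≟_ (monomialOf (lookup v)) L)
                 (allVecs (deduplicate ℤ._≟_ L) n))

Kback : ∀ {n} → FinPoset n → (Fin n → Letter) → Series
Kback P Φ L = + countPPartitions P Φ L / 1

-- Let b lie below every letter value.  Call g a relabelling of a set E of indices if it is
-- strictly increasing on E and moves only indices ≤ b, keeping them ≤ b.  Every condition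
-- defining a slide or a back stable (P,Φ)-partition compares two indices, or an index with a
-- letter value ≥ b, and such comparisons are unchanged by g; so both series have the same
-- coefficient at L and at g(L).  Sending i₁ < ⋯ < iₖ ≤ b to j₁ < ⋯ < jₖ ≤ b while fixing the
-- indices above b is a relabelling, which gives back quasisymmetry.  Bounded degree and the
-- absence of large variables are read off from the support: a slide of W is a sum of monomials
-- of degree |W|, a (P,Φ)-partition has |P| values, and all of these lie below the largest
-- letter value.

module Submission where

open import Defs
open import Data.Nat using (ℕ)
open import Data.Fin using (Fin)
open import Data.Product using (_×_)
open import Function.Definitions using (Injective)
open import Relation.Binary.PropositionalEquality using (_≡_)

import Data.Nat as ℕ
import Data.Nat.Properties as ℕP
open import Data.Integer as ℤ using (ℤ; 0ℤ)
import Data.Integer.Properties as ℤP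
open import Data.Fin using (zero; suc)
open import Data.Vec as Vec using (Vec; []; _∷_; lookup)
import Data.Vec.Properties as VecP
open import Data.List as List
  using (List; []; _∷_; _++_; length; map; reverse; replicate; concat; concatMap;
         zipWith; filter; deduplicate; allFin)
import Data.List.Properties as ListP
open import Data.List.Relation.Unary.All as All using (All; []; _∷_)
import Data.List.Relation.Unary.All.Properties as AllP
open import Data.List.Relation.Unary.Any using (here; there)
open import Data.List.Relation.Unary.Linked as Linked using (Linked; [-]; _∷_)
import Data.List.Relation.Unary.Linked.Properties as LinkedP
open import Data.List.Membership.Propositional using (_∈_)
open import Data.List.Relation.Binary.Permutation.Propositional using (_↭_; ↭-sym; ↭-trans)
open import Data.List.Relation.Binary.Permutation.Propositional.Properties
  using (↭-length; All-resp-↭; ↭-reverse)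
open import Data.List.Sort.InsertionSort.Properties ℤP.≤-decTotalOrder using (sort-↭)
open import Data.List.Extrema ℤP.≤-totalOrder using (min; max; min≤xs; xs≤max)
open import Data.Product using (∃-syntax; _,_; proj₁; proj₂)
open import Data.Product.Function.NonDependent.Propositional using (_×-⇔_)
open import Data.Sum using (_⊎_; inj₁; inj₂)
open import Data.Empty using (⊥-elim)
open import Data.Rational using (0ℚ; 1ℚ; _/_)
open import Data.Bool using (if_then_else_)
open import Function using (_∘_; id)
open import Function.Bundles using (_⇔_; mk⇔; Equivalence)
open import Relation.Nullary using (¬_; Dec; yes; no; ¬?; _×-dec_)
open import Relation.Nullary.Decidable using (⌊_⌋; does-⇔; isYes≗does)
open import Relation.Unary using (Decidable)
open import Relation.Binary.PropositionalEquality
  using (_≢_; _≗_; refl; sym; trans; cong; cong₂; subst; subst₂; module ≡-Reasoning)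

open Equivalence using (to; from)

SupportedOn : (List ℤ → Set) → Series → Set
SupportedOn S F = ∀ L → ¬ S L → F L ≡ 0ℚ

module _ {S : List ℤ → Set} {F : Series} (F-supported : SupportedOn S F) where

  supported⇒boundedDegree : (D : ℕ) → (∀ {L} → S L → length L ℕ.≤ D) → BoundedDegree F
  supported⇒boundedDegree D bound =
    D , λ L _ D<L → F-supported L (λ s → ℕP.<⇒≱ D<L (bound s))

  supported⇒noLargeVariables : (N : ℤ) → (∀ {L} → S L → All (ℤ._≤ N) L) → NoLargeVariables F
  supported⇒noLargeVariables N bound =
    N , λ L _ large → F-supported L (λ s → AllP.All¬⇒¬Any (All.map ℤP.≤⇒≯ (bound s)) large)

-- Relabellings

record Relabelling (b : ℤ) (E : ℤ → Set) (g : ℤ → ℤ) : Set where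
  field
    strictMonoOn : ∀ {x y} → E x → E y → x ℤ.< y → g x ℤ.< g y
    fixedOrBelow : ∀ {x} → E x → g x ≡ x ⊎ (x ℤ.≤ b × g x ℤ.≤ b)

  monoOn : ∀ {x y} → E x → E y → x ℤ.≤ y → g x ℤ.≤ g y
  monoOn {x} {y} ex ey x≤y with x ℤ.≟ y
  ... | yes refl = ℤP.≤-refl
  ... | no x≢y   = ℤP.<⇒≤ (strictMonoOn ex ey (ℤP.≤∧≢⇒< x≤y x≢y))

  <-iff : ∀ {x y} → E x → E y → (x ℤ.< y) ⇔ (g x ℤ.< g y)
  <-iff ex ey = mk⇔ (strictMonoOn ex ey)
    (λ gx<gy → ℤP.≰⇒> (λ y≤x → ℤP.<⇒≱ gx<gy (monoOn ey ex y≤x)))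

  ≤-iff : ∀ {x y} → E x → E y → (x ℤ.≤ y) ⇔ (g x ℤ.≤ g y)
  ≤-iff ex ey = mk⇔ (monoOn ex ey)
    (λ gx≤gy → ℤP.≮⇒≥ (λ y<x → ℤP.<⇒≱ (strictMonoOn ey ex y<x) gx≤gy))

  injectiveOn : ∀ {x y} → E x → E y → g x ≡ g y → x ≡ y
  injectiveOn ex ey gx≡gy = ℤP.≤-antisym
    (from (≤-iff ex ey) (ℤP.≤-reflexive gx≡gy)) (from (≤-iff ey ex) (ℤP.≤-reflexive (sym gx≡gy)))

  ≤-bound-iff : ∀ {x c} → E x → b ℤ.≤ c → (x ℤ.≤ c) ⇔ (g x ℤ.≤ c)
  ≤-bound-iff {c = c} ex b≤c with fixedOrBelow ex
  ... | inj₁ gx≡x          = mk⇔ (subst (ℤ._≤ c) (sym gx≡x)) (subst (ℤ._≤ c) gx≡x)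
  ... | inj₂ (x≤b , gx≤b) = mk⇔ (λ _ → ℤP.≤-trans gx≤b b≤c) (λ _ → ℤP.≤-trans x≤b b≤c)

RelabellingInvariant : ℤ → Series → Set₁
RelabellingInvariant b F = ∀ {E g} → Relabelling b E g → ∀ L → All E L → F (map g L) ≡ F L

-- Moving a block of indices below b

block-∷ : ∀ i is a as → block (i ∷ is) (a ∷ as) ≡ block is as ++ replicate a i
block-∷ i is a as = begin
  concat (reverse (replicate a i ∷ rows))
    ≡⟨ cong concat (ListP.unfold-reverse (replicate a i) rows) ⟩
  concat (reverse rows ++ replicate a i ∷ [])
    ≡⟨ sym (ListP.concat-++ (reverse rows) (replicate a i ∷ [])) ⟩
  block is as ++ replicate a i ++ []
    ≡⟨ cong (block is as ++_) (ListP.++-identityʳ (replicate a i)) ⟩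
  block is as ++ replicate a i ∎
  where
  open ≡-Reasoning
  rows : List (List ℤ)
  rows = zipWith (λ i a → replicate a i) is as

All-block : ∀ {P : ℤ → Set} is as → All P is → All P (block is as)
All-block []       as       _        = []
All-block (i ∷ is) []       _        = []
All-block {P} (i ∷ is) (a ∷ as) (p ∷ ps) = subst (All P) (sym (block-∷ i is a as))
  (AllP.++⁺ (All-block is as ps) (AllP.replicate⁺ a p))

linked-head : ∀ {i is} → Linked ℤ._<_ (i ∷ is) → All (i ℤ.<_) is
linked-head [-]            = []
linked-head (i<j ∷ linked) = LinkedP.Linked⇒All ℤP.<-trans i<j linked

relabel : List ℤ → List ℤ → ℤ → ℤ
relabel (i ∷ is) (j ∷ js) x with x ℤ.≟ i
... | yes _ = j
... | no  _ = relabel is js x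
relabel _ _ x = x

relabel-hit : ∀ i is j js → relabel (i ∷ is) (j ∷ js) i ≡ j
relabel-hit i is j js with i ℤ.≟ i
... | yes _  = refl
... | no i≢i = ⊥-elim (i≢i refl)

relabel-miss : ∀ {x} i is j js → x ≢ i → relabel (i ∷ is) (j ∷ js) x ≡ relabel is js x
relabel-miss {x} i is j js x≢i with x ℤ.≟ i
... | yes x≡i = ⊥-elim (x≢i x≡i)
... | no  _   = refl

relabel-outside : ∀ {x} is js → All (x ≢_) is → relabel is js x ≡ x
relabel-outside []       js       _            = refl
relabel-outside (i ∷ is) []       _            = refl
relabel-outside (i ∷ is) (j ∷ js) (x≢i ∷ x∉is) =
  trans (relabel-miss i is j js x≢i) (relabel-outside is js x∉is)

relabel-∈ : ∀ {x} is js → length is ≡ length js → x ∈ is → relabel is js x ∈ js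
relabel-∈ (i ∷ is) (j ∷ js) _ (here refl) = here (relabel-hit i is j js)
relabel-∈ {x} (i ∷ is) (j ∷ js) len (there x∈is) with x ℤ.≟ i
... | yes _ = here refl
... | no  _ = there (relabel-∈ is js (ℕP.suc-injective len) x∈is)

<⇒≢ : ∀ {i x} → i ℤ.< x → x ≢ i
<⇒≢ i<x x≡i = ℤP.<-irrefl (sym x≡i) i<x

relabel-strictMonoOn : ∀ {x y} is js → Linked ℤ._<_ is → Linked ℤ._<_ js → length is ≡ length js →
  x ∈ is → y ∈ is → x ℤ.< y → relabel is js x ℤ.< relabel is js y
relabel-strictMonoOn (i ∷ is) (j ∷ js) _ _ _ (here refl) (here refl) x<x = ⊥-elim (ℤP.<-irrefl refl x<x)
relabel-strictMonoOn (i ∷ is) (j ∷ js) is↗ js↗ len (here refl) (there y∈is) i<y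
  rewrite relabel-hit i is j js | relabel-miss i is j js (<⇒≢ i<y) =
  All.lookup (linked-head js↗) (relabel-∈ is js (ℕP.suc-injective len) y∈is)
relabel-strictMonoOn (i ∷ is) (j ∷ js) is↗ _ _ (there x∈is) (here refl) x<i =
  ⊥-elim (ℤP.<-asym x<i (All.lookup (linked-head is↗) x∈is))
relabel-strictMonoOn (i ∷ is) (j ∷ js) is↗ js↗ len (there x∈is) (there y∈is) x<y
  rewrite relabel-miss i is j js (<⇒≢ (All.lookup (linked-head is↗) x∈is))
        | relabel-miss i is j js (<⇒≢ (All.lookup (linked-head is↗) y∈is)) =
  relabel-strictMonoOn is js (Linked.tail is↗) (Linked.tail js↗) (ℕP.suc-injective len) x∈is y∈is x<y

map-relabel-block : ∀ is js as → Linked ℤ._<_ is → length is ≡ length as → length js ≡ length as →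
  map (relabel is js) (block is as) ≡ block js as
map-relabel-block []       []       []       _   _    _    = refl
map-relabel-block (i ∷ is) (j ∷ js) (a ∷ as) is↗ len₁ len₂ = begin
  map (relabel (i ∷ is) (j ∷ js)) (block (i ∷ is) (a ∷ as))
    ≡⟨ cong (map _) (block-∷ i is a as) ⟩
  map (relabel (i ∷ is) (j ∷ js)) (block is as ++ replicate a i)
    ≡⟨ ListP.map-++ _ (block is as) (replicate a i) ⟩
  map (relabel (i ∷ is) (j ∷ js)) (block is as) ++ map (relabel (i ∷ is) (j ∷ js)) (replicate a i)
    ≡⟨ cong₂ _++_ (ListP.map-cong-local (All.map (relabel-miss i is j js ∘ <⇒≢)
                                                  (All-block is as (linked-head is↗))))
                  (ListP.map-replicate _ a i) ⟩
  map (relabel is js) (block is as) ++ replicate a (relabel (i ∷ is) (j ∷ js) i)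
    ≡⟨ cong₂ _++_ (map-relabel-block is js as (Linked.tail is↗)
                                     (ℕP.suc-injective len₁) (ℕP.suc-injective len₂))
                  (cong (replicate a) (relabel-hit i is j js)) ⟩
  block js as ++ replicate a j
    ≡⟨ sym (block-∷ j js a as) ⟩
  block (j ∷ js) (a ∷ as) ∎
  where open ≡-Reasoning

module _ {b : ℤ} {is js : List ℤ}
  (is↗ : Linked ℤ._<_ is) (js↗ : Linked ℤ._<_ js) (len : length is ≡ length js)
  (is≤b : All (ℤ._≤ b) is) (js≤b : All (ℤ._≤ b) js) where

  AboveOrIn : ℤ → Set
  AboveOrIn x = b ℤ.< x ⊎ x ∈ is

  private
    relabel-above : ∀ {x} → b ℤ.< x → relabel is js x ≡ x
    relabel-above b<x = relabel-outside is js (All.map (λ i≤b → <⇒≢ (ℤP.≤-<-trans i≤b b<x)) is≤b)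

  relabel-relabelling : Relabelling b AboveOrIn (relabel is js)
  relabel-relabelling = record { strictMonoOn = strictMonoOn ; fixedOrBelow = fixedOrBelow }
    where
    strictMonoOn : ∀ {x y} → AboveOrIn x → AboveOrIn y → x ℤ.< y → relabel is js x ℤ.< relabel is js y
    strictMonoOn (inj₁ b<x) (inj₁ b<y) x<y
      rewrite relabel-above b<x | relabel-above b<y = x<y
    strictMonoOn (inj₂ x∈is) (inj₁ b<y) _
      rewrite relabel-above b<y = ℤP.≤-<-trans (All.lookup js≤b (relabel-∈ is js len x∈is)) b<y
    strictMonoOn (inj₁ b<x) (inj₂ y∈is) x<y =
      ⊥-elim (ℤP.<-asym x<y (ℤP.≤-<-trans (All.lookup is≤b y∈is) b<x))
    strictMonoOn (inj₂ x∈is) (inj₂ y∈is) x<y = relabel-strictMonoOn is js is↗ js↗ len x∈is y∈is x<y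

    fixedOrBelow : ∀ {x} → AboveOrIn x → relabel is js x ≡ x ⊎ (x ℤ.≤ b × relabel is js x ℤ.≤ b)
    fixedOrBelow (inj₁ b<x)  = inj₁ (relabel-above b<x)
    fixedOrBelow (inj₂ x∈is) = inj₂ (All.lookup is≤b x∈is , All.lookup js≤b (relabel-∈ is js len x∈is))

  relabel-monomial : ∀ m as → All (b ℤ.<_) m → length is ≡ length as → length js ≡ length as →
    map (relabel is js) (m ++ block is as) ≡ m ++ block js as
  relabel-monomial m as b<m len₁ len₂ = begin
    map (relabel is js) (m ++ block is as)
      ≡⟨ ListP.map-++ _ m (block is as) ⟩
    map (relabel is js) m ++ map (relabel is js) (block is as)
      ≡⟨ cong₂ _++_ (trans (ListP.map-cong-local (All.map relabel-above b<m)) (ListP.map-id m))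
                    (map-relabel-block is js as is↗ len₁ len₂) ⟩
    m ++ block js as ∎
    where open ≡-Reasoning

relabellingInvariant⇒backQuasisymmetric : ∀ {b F} → RelabellingInvariant b F → BackQuasisymmetric F
relabellingInvariant⇒backQuasisymmetric {b} {F} invariant =
  b , λ as _ m _ b<m is js len₁ is↗ is≤b len₂ js↗ js≤b →
    let len = trans len₁ (sym len₂) in
    begin
      F (m ++ block is as)
        ≡⟨ sym (invariant (relabel-relabelling is↗ js↗ len is≤b js≤b) (m ++ block is as)
                 (AllP.++⁺ (All.map inj₁ b<m) (All-block is as (All.tabulate inj₂)))) ⟩
      F (map (relabel is js) (m ++ block is as))
        ≡⟨ cong F (relabel-monomial is↗ js↗ len is≤b js≤b m as b<m len₁ len₂) ⟩
      F (m ++ block js as) ∎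
  where open ≡-Reasoning

supported∧invariant⇒inQR : ∀ {S F} (D : ℕ) (N b : ℤ) → SupportedOn S F →
  (∀ {L} → S L → length L ℕ.≤ D × All (ℤ._≤ N) L) → RelabellingInvariant b F → InQR F
supported∧invariant⇒inQR D N b F-supported bounds invariant =
  supported⇒boundedDegree F-supported D (proj₁ ∘ bounds) ,
  supported⇒noLargeVariables F-supported N (proj₂ ∘ bounds) ,
  relabellingInvariant⇒backQuasisymmetric invariant

-- Slides

slideCond-length : ∀ w L → SlideCond w L → length L ≡ length w
slideCond-length []          []          _             = refl
slideCond-length (a ∷ [])    (i ∷ [])    _             = refl
slideCond-length (a ∷ c ∷ w) (i ∷ k ∷ L) (_ , _ , _ , s) = cong ℕ.suc (slideCond-length (c ∷ w) (k ∷ L) s)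

slideCond-≤ : ∀ {N} w L → All (λ a → val a ℤ.≤ N) w → SlideCond w L → All (ℤ._≤ N) L
slideCond-≤ []          []          _          _                 = []
slideCond-≤ (a ∷ [])    (i ∷ [])    (a≤N ∷ _)  i≤a               = ℤP.≤-trans i≤a a≤N ∷ []
slideCond-≤ (a ∷ c ∷ w) (i ∷ k ∷ L) (a≤N ∷ w≤N) (i≤a , _ , _ , s) =
  ℤP.≤-trans i≤a a≤N ∷ slideCond-≤ (c ∷ w) (k ∷ L) w≤N s

slide-supported : ∀ w → SupportedOn (SlideCond w) (slide w)
slide-supported w L ¬s with slideCond? w L
... | yes s = ⊥-elim (¬s s)
... | no  _ = refl

⌊⌋-⇔ : {A B : Set} → A ⇔ B → (a? : Dec A) (b? : Dec B) → ⌊ a? ⌋ ≡ ⌊ b? ⌋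
⌊⌋-⇔ A⇔B a? b? = trans (isYes≗does a?) (trans (does-⇔ A⇔B a? b?) (sym (isYes≗does b?)))

→-cong-⇔ : {A B C : Set} → B ⇔ C → (A → B) ⇔ (A → C)
→-cong-⇔ B⇔C = mk⇔ (to B⇔C ∘_) (from B⇔C ∘_)

slideCond-relabel : ∀ {b E g} → Relabelling b E g → ∀ w L → All (λ a → b ℤ.≤ val a) w → All E L →
  SlideCond w L ⇔ SlideCond w (map g L)
slideCond-relabel rel []          []          _ _ = mk⇔ id id
slideCond-relabel rel []          (_ ∷ _)     _ _ = mk⇔ (λ ()) (λ ())
slideCond-relabel rel (_ ∷ _)     []          _ _ = mk⇔ (λ ()) (λ ())
slideCond-relabel rel (a ∷ [])    (i ∷ [])    (b≤a ∷ _) (ei ∷ _) = Relabelling.≤-bound-iff rel ei b≤a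
slideCond-relabel rel (a ∷ [])    (_ ∷ _ ∷ _) _ _ = mk⇔ (λ ()) (λ ())
slideCond-relabel rel (a ∷ _ ∷ _) (_ ∷ [])    _ _ = mk⇔ (λ ()) (λ ())
slideCond-relabel rel (a ∷ c ∷ w) (i ∷ k ∷ L) (b≤a ∷ b≤w) (ei ∷ ek ∷ eL) =
  ≤-bound-iff ei b≤a ×-⇔ ≤-iff ek ei ×-⇔ →-cong-⇔ (<-iff ek ei) ×-⇔
  slideCond-relabel rel (c ∷ w) (k ∷ L) b≤w (ek ∷ eL)
  where open Relabelling rel

slide-relabellingInvariant : ∀ {b} w → All (λ a → b ℤ.≤ val a) w → RelabellingInvariant b (slide w)
slide-relabellingInvariant w b≤w {g = g} rel L eL =
  cong (λ accept → if accept then 1ℚ else 0ℚ)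
       (sym (⌊⌋-⇔ (slideCond-relabel rel w L b≤w eL) (slideCond? w L) (slideCond? w (map g L))))

slide-inQR : ∀ w → InQR (slide w)
slide-inQR w =
  supported∧invariant⇒inQR (length w) (max 0ℤ (map val w)) (min 0ℤ (map val w)) (slide-supported w)
    (λ {L} s → ℕP.≤-reflexive (slideCond-length w L s) ,
               slideCond-≤ w L (AllP.map⁻ (xs≤max 0ℤ (map val w))) s)
    (slide-relabellingInvariant w (AllP.map⁻ (min≤xs 0ℤ (map val w))))

-- Back stable (P,Φ)-partitions

filter-map-⇔ : ∀ {A B : Set} {P : A → Set} {Q : B → Set} (P? : Decidable P) (Q? : Decidable Q)
  (h : A → B) xs → All (λ x → P x ⇔ Q (h x)) xs → filter Q? (map h xs) ≡ map h (filter P? xs)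
filter-map-⇔ P? Q? h []       _               = refl
filter-map-⇔ P? Q? h (x ∷ xs) (Px⇔Qhx ∷ rest) with P? x | Q? (h x)
... | yes _  | yes _ = cong (h x ∷_) (filter-map-⇔ P? Q? h xs rest)
... | no  _  | no  _ = filter-map-⇔ P? Q? h xs rest
... | yes px | no ¬q = ⊥-elim (¬q (to Px⇔Qhx px))
... | no ¬px | yes q = ⊥-elim (¬px (from Px⇔Qhx q))

allVecs-map : ∀ (g : ℤ → ℤ) S n → allVecs (map g S) n ≡ map (Vec.map g) (allVecs S n)
allVecs-map g S ℕ.zero    = refl
allVecs-map g S (ℕ.suc n) =
  trans (cong (λ A → concatMap (λ y → map (y ∷_) A) (map g S)) (allVecs-map g S n)) (prepend-map S)
  where
  A : List (Vec ℤ n)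
  A = allVecs S n
  prepend-map : ∀ S → concatMap (λ y → map (y ∷_) (map (Vec.map g) A)) (map g S)
                    ≡ map (Vec.map g) (concatMap (λ x → map (x ∷_) A) S)
  prepend-map []      = refl
  prepend-map (x ∷ S) = trans (cong₂ _++_ (trans (sym (ListP.map-∘ A)) (ListP.map-∘ A)) (prepend-map S))
                              (sym (ListP.map-++ (Vec.map g) (map (x ∷_) A) _))

allVecs-All : ∀ {E : ℤ → Set} S n → All E S → All (λ v → ∀ i → E (lookup v i)) (allVecs S n)
allVecs-All S ℕ.zero    _  = (λ ()) ∷ []
allVecs-All S (ℕ.suc n) eS = AllP.concat⁺ (AllP.map⁺ (All.map (λ ex → AllP.map⁺
  (All.map (λ ev → λ { zero → ex ; (suc i) → ev i }) (allVecs-All S n eS))) eS))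

PPartitionWithMonomial : ∀ {n} → FinPoset n → (Fin n → Letter) → List ℤ → (Fin n → ℤ) → Set
PPartitionWithMonomial P Φ L f = IsPPartition P Φ f × monomialOf f ≡ L

monomialOf-↭ : ∀ {n} (f : Fin n → ℤ) → monomialOf f ↭ map f (allFin n)
monomialOf-↭ f = ↭-trans (↭-reverse _) (sort-↭ _)

monomialOf-length : ∀ {n} (f : Fin n → ℤ) → length (monomialOf f) ≡ n
monomialOf-length {n} f = trans (↭-length (monomialOf-↭ f))
  (trans (ListP.length-map f (allFin n)) (ListP.length-tabulate id))

All-monomialOf : ∀ {n} {P : ℤ → Set} (f : Fin n → ℤ) → (∀ u → P (f u)) → All P (monomialOf f)
All-monomialOf {n} f pf = All-resp-↭ (↭-sym (monomialOf-↭ f)) (AllP.map⁺ (All.universal pf (allFin n)))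

PPartitionWithMonomial-resp-≗ : ∀ {n} (P : FinPoset n) Φ {L} {f f' : Fin n → ℤ} → f ≗ f' →
  PPartitionWithMonomial P Φ L f → PPartitionWithMonomial P Φ L f'
PPartitionWithMonomial-resp-≗ {n} P Φ f≗f' ((covers , bounded) , monomial≡L) =
  ((λ u v u≺v → subst₂ ℤ._≤_ (f≗f' v) (f≗f' u) (proj₁ (covers u v u≺v)) ,
                subst₂ ℤ._<_ (f≗f' v) (f≗f' u) ∘ proj₂ (covers u v u≺v)) ,
   (λ u → subst (ℤ._≤ _) (f≗f' u) (bounded u))) ,
  trans (cong (reverse ∘ ℤSort.sort) (sym (ListP.map-cong f≗f' (allFin n)))) monomial≡L

pPartitionWithMonomial? : ∀ {n} (P : FinPoset n) Φ L → Decidable (PPartitionWithMonomial P Φ L ∘ lookup)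
pPartitionWithMonomial? P Φ L v =
  isPPartition? P Φ (lookup v) ×-dec ListP.≡-dec ℤ._≟_ (monomialOf (lookup v)) L

Kback-supported : ∀ {n} (P : FinPoset n) Φ →
  SupportedOn (λ L → ∃[ f ] PPartitionWithMonomial P Φ L f) (Kback P Φ)
Kback-supported {n} P Φ L none = cong (λ k → ℤ.+ k / 1) (cong length
  (ListP.filter-none (pPartitionWithMonomial? P Φ L)
    (All.universal (λ v → none ∘ (lookup v ,_)) (allVecs (deduplicate ℤ._≟_ L) n))))

module _ {b E g} (rel : Relabelling b E g) where
  open Relabelling rel

  map-injectiveOn : ∀ {xs ys} → All E xs → All E ys → map g xs ≡ map g ys → xs ≡ ys
  map-injectiveOn []         []         _  = refl
  map-injectiveOn (ex ∷ exs) (ey ∷ eys) eq =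
    cong₂ _∷_ (injectiveOn ex ey (ListP.∷-injectiveˡ eq)) (map-injectiveOn exs eys (ListP.∷-injectiveʳ eq))

  deduplicate-map : ∀ K → All E K → deduplicate ℤ._≟_ (map g K) ≡ map g (deduplicate ℤ._≟_ K)
  deduplicate-map []      _         = refl
  deduplicate-map (x ∷ K) (ex ∷ eK) = cong (g x ∷_) (trans
    (cong (filter (¬? ∘ (g x ℤ.≟_))) (deduplicate-map K eK))
    (filter-map-⇔ (¬? ∘ (x ℤ.≟_)) (¬? ∘ (g x ℤ.≟_)) g _
      (All.map (λ ed → mk⇔ (λ x≢d → x≢d ∘ injectiveOn ex ed) (λ gx≢gd → gx≢gd ∘ cong g))
               (AllP.deduplicate⁺ ℤ._≟_ eK))))

  insert-map : ∀ x ys → E x → All E ys → ℤSort.insert (g x) (map g ys) ≡ map g (ℤSort.insert x ys)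
  insert-map x []       _  _         = refl
  insert-map x (y ∷ ys) ex (ey ∷ eys) with g x ℤP.≤? g y | x ℤP.≤? y
  ... | yes _   | yes _   = refl
  ... | no  _   | no  _   = cong (g y ∷_) (insert-map x ys ex eys)
  ... | yes gx≤gy | no x≰y = ⊥-elim (x≰y (from (≤-iff ex ey) gx≤gy))
  ... | no gx≰gy  | yes x≤y = ⊥-elim (gx≰gy (to (≤-iff ex ey) x≤y))

  sort-map : ∀ xs → All E xs → ℤSort.sort (map g xs) ≡ map g (ℤSort.sort xs)
  sort-map []       _         = refl
  sort-map (x ∷ xs) (ex ∷ exs) = trans (cong (ℤSort.insert (g x)) (sort-map xs exs))
    (insert-map x (ℤSort.sort xs) ex (All-resp-↭ (↭-sym (sort-↭ xs)) exs))

  monomialOf-relabel : ∀ {n} (f : Fin n → ℤ) → (∀ u → E (f u)) → monomialOf (g ∘ f) ≡ map g (monomialOf f)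
  monomialOf-relabel {n} f ef = begin
    reverse (ℤSort.sort (map (g ∘ f) (allFin n)))
      ≡⟨ cong (reverse ∘ ℤSort.sort) (ListP.map-∘ (allFin n)) ⟩
    reverse (ℤSort.sort (map g values))
      ≡⟨ cong reverse (sort-map values (AllP.map⁺ (All.universal ef (allFin n)))) ⟩
    reverse (map g (ℤSort.sort values))
      ≡⟨ sym (ListP.reverse-map g (ℤSort.sort values)) ⟩
    map g (reverse (ℤSort.sort values)) ∎
    where
    open ≡-Reasoning
    values : List ℤ
    values = map f (allFin n)

  module _ {n} (P : FinPoset n) (Φ : Fin n → Letter) (b≤Φ : ∀ u → b ℤ.≤ val (Φ u)) where

    IsPPartition-relabel : ∀ {f} → (∀ u → E (f u)) → IsPPartition P Φ f ⇔ IsPPartition P Φ (g ∘ f)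
    IsPPartition-relabel ef = mk⇔
      (λ (covers , bounded) →
         (λ u v u≺v → to (≤-iff (ef v) (ef u)) (proj₁ (covers u v u≺v)) ,
                      to (<-iff (ef v) (ef u)) ∘ proj₂ (covers u v u≺v)) ,
         (λ u → to (≤-bound-iff (ef u) (b≤Φ u)) (bounded u)))
      (λ (covers , bounded) →
         (λ u v u≺v → from (≤-iff (ef v) (ef u)) (proj₁ (covers u v u≺v)) ,
                      from (<-iff (ef v) (ef u)) ∘ proj₂ (covers u v u≺v)) ,
         (λ u → from (≤-bound-iff (ef u) (b≤Φ u)) (bounded u)))

    PPartitionWithMonomial-relabel : ∀ {f L} → (∀ u → E (f u)) → All E L →
      PPartitionWithMonomial P Φ L f ⇔ PPartitionWithMonomial P Φ (map g L) (g ∘ f)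
    PPartitionWithMonomial-relabel {f} ef eL = IsPPartition-relabel ef ×-⇔ mk⇔
      (λ monomial≡L → trans (monomialOf-relabel f ef) (cong (map g) monomial≡L))
      (λ monomial≡gL → map-injectiveOn (All-monomialOf f ef) eL
                         (trans (sym (monomialOf-relabel f ef)) monomial≡gL))

    countPPartitions-relabel : ∀ K → All E K → countPPartitions P Φ (map g K) ≡ countPPartitions P Φ K
    countPPartitions-relabel K eK = begin
      length (filter (accepts (map g K)) (allVecs (deduplicate ℤ._≟_ (map g K)) n))
        ≡⟨ cong (λ S → length (filter (accepts (map g K)) (allVecs S n))) (deduplicate-map K eK) ⟩
      length (filter (accepts (map g K)) (allVecs (map g S) n))
        ≡⟨ cong (length ∘ filter (accepts (map g K))) (allVecs-map g S n) ⟩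
      length (filter (accepts (map g K)) (map (Vec.map g) (allVecs S n)))
        ≡⟨ cong length (filter-map-⇔ (accepts K) (accepts (map g K)) (Vec.map g) (allVecs S n)
             (All.map (λ {v} → accepts-relabel v) (allVecs-All S n (AllP.deduplicate⁺ ℤ._≟_ eK)))) ⟩
      length (map (Vec.map g) (filter (accepts K) (allVecs S n)))
        ≡⟨ ListP.length-map (Vec.map g) (filter (accepts K) (allVecs S n)) ⟩
      length (filter (accepts K) (allVecs S n)) ∎
      where
      open ≡-Reasoning
      S : List ℤ
      S = deduplicate ℤ._≟_ K
      accepts : ∀ L → Decidable (PPartitionWithMonomial P Φ L ∘ lookup)
      accepts = pPartitionWithMonomial? P Φ

      accepts-relabel : ∀ v → (∀ i → E (lookup v i)) →
        PPartitionWithMonomial P Φ K (lookup v) ⇔ PPartitionWithMonomial P Φ (map g K) (lookup (Vec.map g v))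
      accepts-relabel v ev = mk⇔
        (PPartitionWithMonomial-resp-≗ P Φ (λ i → sym (VecP.lookup-map i g v)) ∘ to relabelled)
        (from relabelled ∘ PPartitionWithMonomial-resp-≗ P Φ (λ i → VecP.lookup-map i g v))
        where
        relabelled : PPartitionWithMonomial P Φ K (lookup v)
                   ⇔ PPartitionWithMonomial P Φ (map g K) (g ∘ lookup v)
        relabelled = PPartitionWithMonomial-relabel ev eK

Kback-relabellingInvariant : ∀ {n} (P : FinPoset n) Φ {b} → (∀ u → b ℤ.≤ val (Φ u)) →
  RelabellingInvariant b (Kback P Φ)
Kback-relabellingInvariant P Φ b≤Φ rel L eL =
  cong (λ k → ℤ.+ k / 1) (countPPartitions-relabel rel P Φ b≤Φ L eL)

Kback-inQR : ∀ {n} (P : FinPoset n) Φ → InQR (Kback P Φ)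
Kback-inQR {n} P Φ =
  supported∧invariant⇒inQR n (max 0ℤ values) (min 0ℤ values) (Kback-supported P Φ) bounds
    (Kback-relabellingInvariant P Φ (AllP.tabulate⁻ (AllP.map⁻ (min≤xs 0ℤ values))))
  where
  values : List ℤ
  values = map (val ∘ Φ) (allFin n)
  bounds : ∀ {L} → ∃[ f ] PPartitionWithMonomial P Φ L f → length L ℕ.≤ n × All (ℤ._≤ max 0ℤ values) L
  bounds (f , (_ , bounded) , refl) = ℕP.≤-reflexive (monomialOf-length f) ,
    All-monomialOf f (λ u → ℤP.≤-trans (bounded u) (AllP.tabulate⁻ (AllP.map⁻ (xs≤max 0ℤ values)) u))

proposition4p8 :
    ((c : NVector) → InQR (slideC c)) ×
    ((n : ℕ) (P : FinPoset n) (Φ : Fin n → Letter) → Injective _≡_ _≡_ Φ →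
       InQR (Kback P Φ))
proposition4p8 = (λ c → slide-inQR (W c)) , (λ _ P Φ _ → Kback-inQR P Φ)
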